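{- Let $k$ be a positive integer, $n=2^{2k}+1$, and $B=\{(x,y)\in\mathbb{Z}_n^2: x=2^k y\}$. For every pair of elements $(x_1,y_1),(x_2,y_2)\in B$ there is a unique pair $(x_3,y_3),(x_4,y_4)\in B$ such that, in $\mathbb{Z}_n$, \begin{itemize} \item $x_1+y_1=x_3+y_4$, \item $x_2+y_2=x_4+y_3$, \item $x_3+y_3=x_2+y_1$, \item $x_4+y_4=x_1+y_2$, \item $x_3-y_3=x_1-y_2$, \item $x_2-y_2=x_3-y_4$, \item $x_1-y_1=x_4-y_3$, \item $x_4-y_4=x_2-y_1$. \end{itemize}
   Context: All arithmetic is in $\mathbb{Z}_n$. -}

module Defs where

open import Data.Nat using (ℕ; suc; _+_; _*_; _∸_; _^_)
open import Data.Nat.DivMod using (_mod_)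
open import Data.Fin using (Fin; toℕ)
open import Data.Product using (_×_; _,_)
open import Relation.Binary.PropositionalEquality using (_≡_)

modulus : ℕ → ℕ
modulus k = suc (2 ^ (2 * k))

Zn : ℕ → Set
Zn k = Fin (modulus k)

add : ∀ k → Zn k → Zn k → Zn k
add k a b = (toℕ a + toℕ b) mod modulus k

sub : ∀ k → Zn k → Zn k → Zn k
sub k a b = (toℕ a + (modulus k ∸ toℕ b)) mod modulus k

mul : ∀ k → Zn k → Zn k → Zn k
mul k a b = (toℕ a * toℕ b) mod modulus k


two^ : ∀ k → Zn k
two^ k = (2 ^ k) mod modulus k

InB : ∀ k → Zn k × Zn k → Set
InB k (x , y) = x ≡ mul k (two^ k) y

Conds : ∀ k → (p₁ p₂ p₃ p₄ : Zn k × Zn k) → Set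
Conds k (x₁ , y₁) (x₂ , y₂) (x₃ , y₃) (x₄ , y₄) =
  (x₁ ⊕ y₁ ≡ x₃ ⊕ y₄) ×
  (x₂ ⊕ y₂ ≡ x₄ ⊕ y₃) ×
  (x₃ ⊕ y₃ ≡ x₂ ⊕ y₁) ×
  (x₄ ⊕ y₄ ≡ x₁ ⊕ y₂) ×
  (x₃ ⊖ y₃ ≡ x₁ ⊖ y₂) ×
  (x₂ ⊖ y₂ ≡ x₃ ⊖ y₄) ×
  (x₁ ⊖ y₁ ≡ x₄ ⊖ y₃) ×
  (x₄ ⊖ y₄ ≡ x₂ ⊖ y₁)
  where
  _⊕_ _⊖_ : Zn k → Zn k → Zn k
  _⊕_ = add k
  _⊖_ = sub k
  infixl 6 _⊕_ _⊖_

-- Write n = 2^(2k) + 1, t = 2^k and, for k ≥ 1, h = 2^(2k-1) + 1.  Modulo n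
-- we have t² = -1 and 2h = 1, and a point of B is (t y , y).  Given the points with
-- second coordinates a and b, conditions 3 and 5 say (t+1)c = tb + a and
-- (t-1)c = ta - b for the second coordinate c of the third point, so
-- subtracting gives 2c = (1+t)b + (1-t)a, i.e. c = h((1+t)b + (1-t)a); this
-- is uniqueness.  Conversely this c and its mirror image d (a and b swapped)
-- satisfy all eight conditions: each condition is a linear congruence whose
-- two sides differ by an element of the ideal (t² + 1, 2h - 1), and we give
-- the cofactors explicitly (checked by the ring solver on ℤ).  The conditions
-- come in pairs exchanged by the symmetry (a , c) ↔ (b , d), so four such
-- certificates suffice.

module Submission where

open import Defs
open import Data.Nat using (ℕ; _≤_)
open import Data.Product using (_×_; _,_; ∃!; proj₁; proj₂)
open import Relation.Binary.PropositionalEquality using (_≡_)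

import Data.Nat as ℕ
import Data.Nat.Properties as ℕ
open import Data.Nat.Divisibility using (>⇒∤) renaming (_∣_ to _∣ℕ_)
open import Data.Nat.DivMod using (_mod_)
import Data.Nat.Tactic.RingSolver as ℕSolver
open import Data.Integer using (ℤ; +_; _+_; _*_; _-_; -_; ∣_∣; _/ℕ_)
import Data.Integer.Properties as ℤ
open import Data.Integer.DivMod using (n%ℕd<d; a≡a%ℕn+[a/ℕn]*n)
open import Data.Integer.Divisibility.Signed
  using (_∣_; divides; ∣-reflexive; ∣⇒∣ᵤ; ∣m⇒∣-m; ∣m∣n⇒∣m+n; ∣n⇒∣m*n)
open import Data.Integer.Tactic.RingSolver using (solve-∀)
open import Data.Fin using (Fin; toℕ; fromℕ<)
open import Data.Fin.Properties using (toℕ-fromℕ<; toℕ-injective; toℕ<n; toℕ≤n)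
open import Data.Empty using (⊥-elim)
open import Relation.Binary.Bundles using (Setoid)
open import Relation.Binary.PropositionalEquality
  using (refl; sym; trans; cong; cong₂; subst; module ≡-Reasoning)
import Relation.Binary.Reasoning.Setoid as SetoidReasoning

diff-of-sums : ∀ a b c d → (a + c) - (b + d) ≡ + 1 * (a - b) + + 1 * (c - d)
diff-of-sums = solve-∀

diff-of-diffs : ∀ a b c d → (a - c) - (b - d) ≡ + 1 * (a - b) + - + 1 * (c - d)
diff-of-diffs = solve-∀

diff-of-products : ∀ a b c d → a * c - b * d ≡ c * (a - b) + b * (c - d)
diff-of-products = solve-∀

diff-chain : ∀ a b c → a - c ≡ + 1 * (a - b) + + 1 * (b - c)
diff-chain = solve-∀

diff-swap : ∀ a b → - (a - b) ≡ b - a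
diff-swap = solve-∀

diff-self : ∀ a m → a - a ≡ + 0 * m
diff-self = solve-∀

diff-shift : ∀ b q → (b + q) - b ≡ q
diff-shift = solve-∀

sub-as-shift : ∀ a b n → a + (n - b) ≡ (a - b) + + 1 * n
sub-as-shift = solve-∀

-- Certificates for the four congruences satisfied by
--   c = h((1+t)b + (1-t)a)   and   d = h((1+t)a + (1-t)b):
-- the difference of the two sides as a combination of t² + 1 and 2h - 1.

sum-across-certificate : ∀ t h a b →
  (t * a + a) - (t * (h * ((+ 1 + t) * b + (+ 1 - t) * a)) + h * ((+ 1 + t) * a + (+ 1 - t) * b))
    ≡ (h * a - h * b) * (t * t + + 1) + (- a - t * a) * (h + h - + 1)
sum-across-certificate = solve-∀

sum-along-certificate : ∀ t h a b →
  (t * (h * ((+ 1 + t) * b + (+ 1 - t) * a)) + h * ((+ 1 + t) * b + (+ 1 - t) * a)) - (t * b + a)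
    ≡ (h * b - h * a) * (t * t + + 1) + (a + t * b) * (h + h - + 1)
sum-along-certificate = solve-∀

diff-along-certificate : ∀ t h a b →
  (t * (h * ((+ 1 + t) * b + (+ 1 - t) * a)) - h * ((+ 1 + t) * b + (+ 1 - t) * a)) - (t * a - b)
    ≡ (h * b - h * a) * (t * t + + 1) + (t * a - b) * (h + h - + 1)
diff-along-certificate = solve-∀

diff-across-certificate : ∀ t h a b →
  (t * b - b) - (t * (h * ((+ 1 + t) * b + (+ 1 - t) * a)) - h * ((+ 1 + t) * a + (+ 1 - t) * b))
    ≡ (h * a - h * b) * (t * t + + 1) + (b - t * b) * (h + h - + 1)
diff-across-certificate = solve-∀

double-as-difference : ∀ t h c → (h + h) * c ≡ h * ((t * c + c) - (t * c - c))
double-as-difference = solve-∀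

regroup-partner : ∀ t h a b → h * ((t * b + a) - (t * a - b)) ≡ h * ((+ 1 + t) * b + (+ 1 - t) * a)
regroup-partner = solve-∀

module Congruence (m : ℤ) where

  infix 4 _≈_
  record _≈_ (a b : ℤ) : Set where
    constructor divides-difference
    field
      m∣a-b : m ∣ a - b

  open _≈_ public

  ≈-by : ∀ {a b} p u q v → a - b ≡ p * u + q * v → m ∣ u → m ∣ v → a ≈ b
  ≈-by p u q v eq m∣u m∣v =
    divides-difference (subst (m ∣_) (sym eq) (∣m∣n⇒∣m+n (∣n⇒∣m*n p m∣u) (∣n⇒∣m*n q m∣v)))

  ≈-by-quotient : ∀ {a b} q → a ≡ b + q * m → a ≈ b
  ≈-by-quotient {b = b} q refl = divides-difference (divides q (diff-shift b (q * m)))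

  ≈-refl : ∀ {a} → a ≈ a
  ≈-refl {a} = divides-difference (divides (+ 0) (diff-self a m))

  ≡⇒≈ : ∀ {a b} → a ≡ b → a ≈ b
  ≡⇒≈ refl = ≈-refl

  ≈-sym : ∀ {a b} → a ≈ b → b ≈ a
  ≈-sym {a} {b} (divides-difference m∣a-b) =
    divides-difference (subst (m ∣_) (diff-swap a b) (∣m⇒∣-m m∣a-b))

  ≈-trans : ∀ {a b c} → a ≈ b → b ≈ c → a ≈ c
  ≈-trans {a} {b} {c} a≈b b≈c = ≈-by (+ 1) _ (+ 1) _ (diff-chain a b c) (m∣a-b a≈b) (m∣a-b b≈c)

  ≈-+ : ∀ {a b c d} → a ≈ b → c ≈ d → a + c ≈ b + d
  ≈-+ {a} {b} {c} {d} a≈b c≈d = ≈-by (+ 1) _ (+ 1) _ (diff-of-sums a b c d) (m∣a-b a≈b) (m∣a-b c≈d)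

  ≈-- : ∀ {a b c d} → a ≈ b → c ≈ d → a - c ≈ b - d
  ≈-- {a} {b} {c} {d} a≈b c≈d = ≈-by (+ 1) _ (- + 1) _ (diff-of-diffs a b c d) (m∣a-b a≈b) (m∣a-b c≈d)

  ≈-* : ∀ {a b c d} → a ≈ b → c ≈ d → a * c ≈ b * d
  ≈-* {a} {b} {c} {d} a≈b c≈d = ≈-by c _ b _ (diff-of-products a b c d) (m∣a-b a≈b) (m∣a-b c≈d)

  ≈-setoid : Setoid _ _
  ≈-setoid = record
    { Carrier = ℤ
    ; _≈_ = _≈_
    ; isEquivalence = record { refl = ≈-refl ; sym = ≈-sym ; trans = ≈-trans }
    }

multiple-below-is-zero : ∀ {d r} → d ∣ℕ r → r ℕ.< d → r ≡ 0
multiple-below-is-zero {r = ℕ.zero} _ _ = refl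
multiple-below-is-zero {r = ℕ.suc _} d∣r r<d = ⊥-elim (>⇒∤ r<d d∣r)

module Residues (n : ℕ) .{{_ : ℕ.NonZero n}} where

  open Congruence (+ n)

  ⟦_⟧ : Fin n → ℤ
  ⟦ x ⟧ = + toℕ x

  reduce : ℤ → Fin n
  reduce z = fromℕ< (n%ℕd<d z n)

  ⟦reduce⟧ : ∀ z → ⟦ reduce z ⟧ ≈ z
  ⟦reduce⟧ z = ≈-sym (≈-by-quotient (z /ℕ n) (subst (λ r → z ≡ + r + (z /ℕ n) * + n)
    (sym (toℕ-fromℕ< (n%ℕd<d z n))) (a≡a%ℕn+[a/ℕn]*n z n)))

  ⟦mod⟧ : ∀ m → ⟦ m mod n ⟧ ≈ + m
  ⟦mod⟧ m = ⟦reduce⟧ (+ m)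

  -- Distinct residues are incongruent: their difference is smaller than n.
  ⟦⟧-injective : ∀ {x y} → ⟦ x ⟧ ≈ ⟦ y ⟧ → x ≡ y
  ⟦⟧-injective {x} {y} x≈y =
    toℕ-injective (ℤ.+-injective (ℤ.i-j≡0⇒i≡j _ _ (ℤ.∣i∣≡0⇒i≡0
      (multiple-below-is-zero (∣⇒∣ᵤ (m∣a-b x≈y)) distance<n))))
    where
    distance<n : ∣ ⟦ x ⟧ - ⟦ y ⟧ ∣ ℕ.< n
    distance<n = ℕ.≤-<-trans
      (ℕ.≤-reflexive (cong ∣_∣ (ℤ.[+m]-[+n]≡m⊖n (toℕ x) (toℕ y))))
      (ℕ.≤-<-trans (ℤ.∣m⊝n∣≤m⊔n (toℕ x) (toℕ y)) (ℕ.⊔-lub (toℕ<n x) (toℕ<n y)))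

  ≡-from-≈ : ∀ {u v U V} → ⟦ u ⟧ ≈ U → ⟦ v ⟧ ≈ V → U ≈ V → u ≡ v
  ≡-from-≈ u≈U v≈V U≈V = ⟦⟧-injective (≈-trans u≈U (≈-trans U≈V (≈-sym v≈V)))

  ≈-from-≡ : ∀ {u v U V} → ⟦ u ⟧ ≈ U → ⟦ v ⟧ ≈ V → u ≡ v → U ≈ V
  ≈-from-≡ u≈U v≈V refl = ≈-trans (≈-sym u≈U) v≈V

module Arithmetic (k : ℕ) where

  open Congruence (+ modulus k)
  open Residues (modulus k)

  ⟦add⟧ : ∀ x y → ⟦ add k x y ⟧ ≈ ⟦ x ⟧ + ⟦ y ⟧
  ⟦add⟧ x y = ≈-trans (⟦mod⟧ _) (≡⇒≈ (ℤ.pos-+ (toℕ x) (toℕ y)))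

  ⟦mul⟧ : ∀ x y → ⟦ mul k x y ⟧ ≈ ⟦ x ⟧ * ⟦ y ⟧
  ⟦mul⟧ x y = ≈-trans (⟦mod⟧ _) (≡⇒≈ (ℤ.pos-* (toℕ x) (toℕ y)))

  -- sub adds the complement n - y, which differs from - y by one multiple of n.
  ⟦sub⟧ : ∀ x y → ⟦ sub k x y ⟧ ≈ ⟦ x ⟧ - ⟦ y ⟧
  ⟦sub⟧ x y = ≈-trans (⟦mod⟧ _) (≈-by-quotient (+ 1) (begin
    + (toℕ x ℕ.+ (modulus k ℕ.∸ toℕ y))      ≡⟨ ℤ.pos-+ (toℕ x) _ ⟩
    ⟦ x ⟧ + + (modulus k ℕ.∸ toℕ y)          ≡⟨ cong (λ w → ⟦ x ⟧ + w) complement ⟩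
    ⟦ x ⟧ + (+ modulus k - ⟦ y ⟧)            ≡⟨ sub-as-shift ⟦ x ⟧ ⟦ y ⟧ (+ modulus k) ⟩
    ⟦ x ⟧ - ⟦ y ⟧ + + 1 * + modulus k        ∎))
    where
    open ≡-Reasoning
    complement : + (modulus k ℕ.∸ toℕ y) ≡ + modulus k - ⟦ y ⟧
    complement = sym (trans (ℤ.[+m]-[+n]≡m⊖n (modulus k) (toℕ y)) (ℤ.⊖-≥ (toℕ≤n y)))

  t : ℤ
  t = + (2 ℕ.^ k)

  ⟦2^k·⟧ : ∀ y {Y} → ⟦ y ⟧ ≈ Y → ⟦ mul k (two^ k) y ⟧ ≈ t * Y
  ⟦2^k·⟧ y y≈Y = ≈-trans (⟦mul⟧ (two^ k) y) (≈-* (⟦mod⟧ (2 ℕ.^ k)) y≈Y)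

  ⟦⊕⟧ : ∀ y z {Y Z} → ⟦ y ⟧ ≈ Y → ⟦ z ⟧ ≈ Z → ⟦ add k (mul k (two^ k) y) z ⟧ ≈ t * Y + Z
  ⟦⊕⟧ y z y≈Y z≈Z = ≈-trans (⟦add⟧ (mul k (two^ k) y) z) (≈-+ (⟦2^k·⟧ y y≈Y) z≈Z)

  ⟦⊖⟧ : ∀ y z {Y Z} → ⟦ y ⟧ ≈ Y → ⟦ z ⟧ ≈ Z → ⟦ sub k (mul k (two^ k) y) z ⟧ ≈ t * Y - Z
  ⟦⊖⟧ y z y≈Y z≈Z = ≈-trans (⟦sub⟧ (mul k (two^ k) y) z) (≈-- (⟦2^k·⟧ y y≈Y) z≈Z)

module Partners (m t h : ℤ) (m∣t²+1 : m ∣ t * t + + 1) (m∣2h-1 : m ∣ h + h - + 1) where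

  open Congruence m

  partner : ℤ → ℤ → ℤ
  partner a b = h * ((+ 1 + t) * b + (+ 1 - t) * a)

  sum-across : ∀ a b → t * a + a ≈ t * partner a b + partner b a
  sum-across a b = ≈-by (h * a - h * b) _ (- a - t * a) _ (sum-across-certificate t h a b) m∣t²+1 m∣2h-1

  sum-along : ∀ a b → t * partner a b + partner a b ≈ t * b + a
  sum-along a b = ≈-by (h * b - h * a) _ (a + t * b) _ (sum-along-certificate t h a b) m∣t²+1 m∣2h-1

  diff-along : ∀ a b → t * partner a b - partner a b ≈ t * a - b
  diff-along a b = ≈-by (h * b - h * a) _ (t * a - b) _ (diff-along-certificate t h a b) m∣t²+1 m∣2h-1

  diff-across : ∀ a b → t * b - b ≈ t * partner a b - partner b a
  diff-across a b = ≈-by (h * a - h * b) _ (b - t * b) _ (diff-across-certificate t h a b) m∣t²+1 m∣2h-1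

  two-halves : h + h ≈ + 1
  two-halves = divides-difference m∣2h-1

  -- The two "along" congruences determine c, since 2 is invertible.
  partner-unique : ∀ {a b c} → t * c + c ≈ t * b + a → t * c - c ≈ t * a - b → c ≈ partner a b
  partner-unique {a} {b} {c} sum diff = begin
    c                                 ≡⟨ sym (ℤ.*-identityˡ c) ⟩
    + 1 * c                           ≈⟨ ≈-* (≈-sym two-halves) (≈-refl {c}) ⟩
    (h + h) * c                       ≡⟨ double-as-difference t h c ⟩
    h * ((t * c + c) - (t * c - c))   ≈⟨ ≈-* (≈-refl {h}) (≈-- sum diff) ⟩
    h * ((t * b + a) - (t * a - b))   ≡⟨ regroup-partner t h a b ⟩
    partner a b                       ∎
    where open SetoidReasoning ≈-setoid

two^k-squared : ∀ k → 2 ℕ.^ k ℕ.* 2 ℕ.^ k ℕ.+ 1 ≡ modulus k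
two^k-squared k = trans (ℕ.+-comm _ 1) (cong ℕ.suc (sym (begin
  2 ℕ.^ (k ℕ.+ (k ℕ.+ 0))      ≡⟨ cong (λ e → 2 ℕ.^ (k ℕ.+ e)) (ℕ.+-identityʳ k) ⟩
  2 ℕ.^ (k ℕ.+ k)              ≡⟨ ℕ.^-distribˡ-+-* 2 k k ⟩
  2 ℕ.^ k ℕ.* 2 ℕ.^ k          ∎)))
  where open ≡-Reasoning

-- (n + 1)/2 = 2^(2k-1) + 1, the inverse of 2 modulo n = 2^(2k) + 1 when k ≥ 1.
half : ℕ → ℕ
half k = ℕ.suc (2 ℕ.^ (2 ℕ.* k ℕ.∸ 1))

double-successor : ∀ p → ℕ.suc p ℕ.+ ℕ.suc p ≡ ℕ.suc (ℕ.suc (2 ℕ.* p))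
double-successor = ℕSolver.solve-∀

half-doubled : ∀ j → half (ℕ.suc j) ℕ.+ half (ℕ.suc j) ≡ ℕ.suc (modulus (ℕ.suc j))
half-doubled j = double-successor (2 ℕ.^ (2 ℕ.* ℕ.suc j ℕ.∸ 1))

module PartnerPoints (j : ℕ) where

  k : ℕ
  k = ℕ.suc j

  open Congruence (+ modulus k)
  open Residues (modulus k)
  open Arithmetic k

  h : ℤ
  h = + half k

  -- t² + 1 and 2h - 1 both equal n.
  n∣t²+1 : + modulus k ∣ t * t + + 1
  n∣t²+1 = ∣-reflexive (sym (trans (cong (_+ + 1) (sym (ℤ.pos-* (2 ℕ.^ k) (2 ℕ.^ k))))
    (trans (sym (ℤ.pos-+ _ 1)) (cong +_ (two^k-squared k)))))

  n∣2h-1 : + modulus k ∣ h + h - + 1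
  n∣2h-1 = ∣-reflexive (sym (cong (_- + 1) (trans (sym (ℤ.pos-+ (half k) (half k)))
    (cong +_ (half-doubled j)))))

  open Partners (+ modulus k) t h n∣t²+1 n∣2h-1

  point : Zn k → Zn k × Zn k
  point y = (mul k (two^ k) y , y)

  partner-point : Zn k → Zn k → Zn k
  partner-point a b = reduce (partner ⟦ a ⟧ ⟦ b ⟧)

  -- Read in ℤ, each condition is a partner congruence for (a , b) or (b , a).
  partners-satisfy : ∀ a b →
    Conds k (point a) (point b) (point (partner-point a b)) (point (partner-point b a))
  partners-satisfy a b =
      ≡-from-≈ (⟦⊕⟧ a a ≈-refl ≈-refl) (⟦⊕⟧ c d c≈ d≈) (sum-across A B)
    , ≡-from-≈ (⟦⊕⟧ b b ≈-refl ≈-refl) (⟦⊕⟧ d c d≈ c≈) (sum-across B A)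
    , ≡-from-≈ (⟦⊕⟧ c c c≈ c≈) (⟦⊕⟧ b a ≈-refl ≈-refl) (sum-along A B)
    , ≡-from-≈ (⟦⊕⟧ d d d≈ d≈) (⟦⊕⟧ a b ≈-refl ≈-refl) (sum-along B A)
    , ≡-from-≈ (⟦⊖⟧ c c c≈ c≈) (⟦⊖⟧ a b ≈-refl ≈-refl) (diff-along A B)
    , ≡-from-≈ (⟦⊖⟧ b b ≈-refl ≈-refl) (⟦⊖⟧ c d c≈ d≈) (diff-across A B)
    , ≡-from-≈ (⟦⊖⟧ a a ≈-refl ≈-refl) (⟦⊖⟧ d c d≈ c≈) (diff-across B A)
    , ≡-from-≈ (⟦⊖⟧ d d d≈ d≈) (⟦⊖⟧ b a ≈-refl ≈-refl) (diff-along B A)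
    where
    A B : ℤ
    A = ⟦ a ⟧
    B = ⟦ b ⟧
    c d : Zn k
    c = partner-point a b
    d = partner-point b a
    c≈ : ⟦ c ⟧ ≈ partner A B
    c≈ = ⟦reduce⟧ (partner A B)
    d≈ : ⟦ d ⟧ ≈ partner B A
    d≈ = ⟦reduce⟧ (partner B A)

  partners-forced : ∀ a b c d → Conds k (point a) (point b) (point c) (point d) →
    (point (partner-point a b) , point (partner-point b a)) ≡ (point c , point d)
  partners-forced a b c d (_ , _ , cond₃ , cond₄ , cond₅ , _ , _ , cond₈) =
    cong₂ (λ c′ d′ → (point c′ , point d′)) (forced cond₃ cond₅) (forced cond₄ cond₈)
    where
    forced : ∀ {a b c} → add k (mul k (two^ k) c) c ≡ add k (mul k (two^ k) b) a →
      sub k (mul k (two^ k) c) c ≡ sub k (mul k (two^ k) a) b → partner-point a b ≡ c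
    forced {a} {b} {c} sum diff = ⟦⟧-injective (≈-trans (⟦reduce⟧ _) (≈-sym
      (partner-unique (≈-from-≡ (⟦⊕⟧ c c ≈-refl ≈-refl) (⟦⊕⟧ b a ≈-refl ≈-refl) sum)
                      (≈-from-≡ (⟦⊖⟧ c c ≈-refl ≈-refl) (⟦⊖⟧ a b ≈-refl ≈-refl) diff))))

lemma2 : (k : ℕ) → 1 ≤ k →
    (p₁ p₂ : Zn k × Zn k) → InB k p₁ → InB k p₂ →
    ∃! _≡_ (λ (q : (Zn k × Zn k) × (Zn k × Zn k)) →
      InB k (proj₁ q) × InB k (proj₂ q) ×
      Conds k p₁ p₂ (proj₁ q) (proj₂ q))
-- k = 0 is excluded by 1 ≤ k; otherwise the partner points are the unique pair.
lemma2 (ℕ.suc j) _ (_ , a) (_ , b) refl refl =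
  (point (partner-point a b) , point (partner-point b a)) ,
  (refl , refl , partners-satisfy a b) ,
  λ { {(_ , c) , (_ , d)} (refl , refl , conds) → partners-forced a b c d conds }
  where open PartnerPoints j
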